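{- There is a computable function $f$ such that for every positive integer $n$, if $H$ is a subdivision of $T_{f(n)}$, then the clique-width of $H$ is greater than $n$.
   Context: For $n\ge 3$ let $G_{n,n}$ be the $n\times n$ grid (vertices $(i,j)$, $1\le i,j\le n$, with $(i,j)$ adjacent to $(i,j+1)$ and $(i+1,j)$ when these exist). $T_n$ is obtained from $G_{n,n}$ by (1) removing every vertex $v$ of degree $2$ and inserting an edge between the two neighbours of $v$, and (2) replacing every vertex $v$ of degree $4$ by four new vertices $v_1,v_2,v_3,v_4$ connected in a $4$-cycle so that the four edges formerly incident on $v$ are now each incident on a distinct one of the new vertices. A graph $H$ is a subdivision of $G$ if it is obtained from $G$ by replacing every edge by a simple path. -}

module Defs where

open import Data.Nat using (ℕ; zero; suc; _+_; _≤_; _∸_; _≤?_)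
open import Data.Fin using (Fin; zero; suc; _≟_)
open import Data.Bool using (Bool; true; false; if_then_else_; _∧_)
open import Data.Product using (Σ; _×_; _,_)
open import Data.Sum using (_⊎_; inj₁; inj₂)
open import Data.Unit using (⊤; tt)
open import Data.Empty using (⊥)
open import Data.List using (List; []; _∷_)
open import Relation.Nullary using (¬_)
open import Relation.Nullary.Decidable using (⌊_⌋)
open import Relation.Binary.PropositionalEquality using (_≡_; _≢_)
open import Function.Bundles using (_↔_; _⇔_; Inverse)

-- Graphs: a vertex type and an (undirected, by construction) adjacency
-- relation.  All graphs that occur in the statement are finite simple
-- graphs (up to isomorphism).

record Graph : Set₁ where
  field
    V : Set
    E : V → V → Set
open Graph public

record _≅_ (G H : Graph) : Set where
  field
    bij : V G ↔ V H
    adj : ∀ x y → E G x y ⇔ E H (Inverse.to bij x) (Inverse.to bij y)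

-- Subdividing the edge uv: add a new vertex w, delete uv,
-- add uw and wv.  H is a subdivision of G (every edge replaced by a
-- simple path) iff H is isomorphic to the result of finitely many such
-- elementary subdivisions applied to G.

subdivE : (G : Graph) (u v : V G) → V G ⊎ ⊤ → V G ⊎ ⊤ → Set
subdivE G u v (inj₁ x) (inj₁ y) =
  E G x y × ¬ ((x ≡ u × y ≡ v) ⊎ (x ≡ v × y ≡ u))
subdivE G u v (inj₁ x) (inj₂ _) = x ≡ u ⊎ x ≡ v
subdivE G u v (inj₂ _) (inj₁ y) = y ≡ u ⊎ y ≡ v
subdivE G u v (inj₂ _) (inj₂ _) = ⊥

subdivideEdge : (G : Graph) (u v : V G) → Graph
subdivideEdge G u v = record { V = V G ⊎ ⊤ ; E = subdivE G u v }

data Subdivision (H : Graph) : Graph → Set₁ where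
  base : ∀ {G} → G ≅ H → Subdivision H G
  step : ∀ {G} (u v : V G) → E G u v →
         Subdivision H (subdivideEdge G u v) → Subdivision H G

-- Clique-width via k-expressions (labels 1..k represented by Fin k).

record LGraph (k : ℕ) : Set₁ where
  field
    LV  : Set
    LE  : LV → LV → Set
    lab : LV → Fin k
open LGraph public

data Expr (k : ℕ) : Set where
  vert   : Fin k → Expr k
  _⊕_    : Expr k → Expr k → Expr k
  ρ      : Fin k → Fin k → Expr k → Expr k
  η      : (i j : Fin k) → i ≢ j → Expr k → Expr k

unionE : {A B : Set} → (A → A → Set) → (B → B → Set) → A ⊎ B → A ⊎ B → Set
unionE EA EB (inj₁ x) (inj₁ y) = EA x y
unionE EA EB (inj₂ x) (inj₂ y) = EB x y
unionE EA EB (inj₁ _) (inj₂ _) = ⊥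
unionE EA EB (inj₂ _) (inj₁ _) = ⊥

unionL : {A B : Set} {k : ℕ} → (A → Fin k) → (B → Fin k) → A ⊎ B → Fin k
unionL la lb (inj₁ x) = la x
unionL la lb (inj₂ y) = lb y

⟦_⟧ : ∀ {k} → Expr k → LGraph k
⟦ vert i ⟧ = record { LV = ⊤ ; LE = λ _ _ → ⊥ ; lab = λ _ → i }
⟦ e₁ ⊕ e₂ ⟧ = record
  { LV = LV ⟦ e₁ ⟧ ⊎ LV ⟦ e₂ ⟧
  ; LE = unionE (LE ⟦ e₁ ⟧) (LE ⟦ e₂ ⟧)
  ; lab = unionL (lab ⟦ e₁ ⟧) (lab ⟦ e₂ ⟧) }
⟦ ρ i j e ⟧ = record
  { LV = LV ⟦ e ⟧
  ; LE = LE ⟦ e ⟧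
  ; lab = λ x → if ⌊ lab ⟦ e ⟧ x ≟ i ⌋ then j else lab ⟦ e ⟧ x }
⟦ η i j _ e ⟧ = record
  { LV = LV ⟦ e ⟧
  ; LE = λ x y → LE ⟦ e ⟧ x y
                 ⊎ (lab ⟦ e ⟧ x ≡ i × lab ⟦ e ⟧ y ≡ j)
                 ⊎ (lab ⟦ e ⟧ x ≡ j × lab ⟦ e ⟧ y ≡ i)
  ; lab = lab ⟦ e ⟧ }

graphOf : ∀ {k} → Expr k → Graph
graphOf e = record { V = LV ⟦ e ⟧ ; E = LE ⟦ e ⟧ }

CWAtMost : ℕ → Graph → Set
CWAtMost k H = Σ (Expr k) λ e → graphOf e ≅ H

CWGreaterThan : ℕ → Graph → Set
CWGreaterThan n H = ∀ k → k ≤ n → ¬ CWAtMost k H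

InGrid : ℕ → ℕ → ℕ → Set
InGrid n i j = (1 ≤ i × i ≤ n) × (1 ≤ j × j ≤ n)

inGridᵇ : ℕ → ℕ → ℕ → Bool
inGridᵇ n i j = ⌊ 1 ≤? i ⌋ ∧ ⌊ i ≤? n ⌋ ∧ ⌊ 1 ≤? j ⌋ ∧ ⌊ j ≤? n ⌋

-- Directions 0 = north (i-1), 1 = east (j+1), 2 = south (i+1), 3 = west (j-1).
-- Dir d (i,j) (i',j') : (i',j') is the position next to (i,j) in direction d.
Dir : Fin 4 → ℕ → ℕ → ℕ → ℕ → Set
Dir zero                   i j i' j' = suc i' ≡ i × j' ≡ j
Dir (suc zero)             i j i' j' = i' ≡ i × j' ≡ suc j
Dir (suc (suc zero))       i j i' j' = i' ≡ suc i × j' ≡ j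
Dir (suc (suc (suc zero))) i j i' j' = i' ≡ i × suc j' ≡ j

GridAdj : ℕ → ℕ → ℕ → ℕ → ℕ → Set
GridAdj n i j i' j' = InGrid n i j × InGrid n i' j' × Σ (Fin 4) λ d → Dir d i j i' j'

b2n : Bool → ℕ
b2n true = 1
b2n false = 0

deg : ℕ → ℕ → ℕ → ℕ
deg n i j = b2n (inGridᵇ n (i ∸ 1) j) + b2n (inGridᵇ n i (suc j))
          + b2n (inGridᵇ n (suc i) j) + b2n (inGridᵇ n i (j ∸ 1))

-- Degree-3 grid vertices are kept; each degree-4 vertex (i,j) is
-- replaced by four vertices (i,j,d), d ∈ Fin 4, where (i,j,d) receives
-- the edge pointing in direction d and the 4-cycle is
-- (i,j,0)-(i,j,1)-(i,j,2)-(i,j,3)-(i,j,0) (N,E,S,W in cyclic order).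
-- Degree-2 vertices (corners) are removed and their two neighbours joined.

data TV (n : ℕ) : Set where
  keep : (i j : ℕ) → InGrid n i j → deg n i j ≡ 3 → TV n
  cyc  : (i j : ℕ) → InGrid n i j → deg n i j ≡ 4 → Fin 4 → TV n

-- Port n i j i' j' x : x is the vertex of T_n that takes over the end at
-- (i,j) of the grid edge between (i,j) and (i',j').
Port : (n : ℕ) → ℕ → ℕ → ℕ → ℕ → TV n → Set
Port n i j i' j' (keep a b _ _)  = a ≡ i × b ≡ j
Port n i j i' j' (cyc a b _ _ d) = (a ≡ i × b ≡ j) × Dir d i j i' j'

next : Fin 4 → Fin 4
next zero                   = suc zero
next (suc zero)             = suc (suc zero)
next (suc (suc zero))       = suc (suc (suc zero))
next (suc (suc (suc zero))) = zero

CycE : (n : ℕ) → TV n → TV n → Set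
CycE n (cyc a b _ _ d) (cyc a' b' _ _ d') = (a ≡ a' × b ≡ b') × d' ≡ next d
CycE n _ _ = ⊥

TR : (n : ℕ) → TV n → TV n → Set
TR n x y =
  (Σ ℕ λ i → Σ ℕ λ j → Σ ℕ λ i' → Σ ℕ λ j' →
     GridAdj n i j i' j' × Port n i j i' j' x × Port n i' j' i j y)
  -- edges replacing a removed degree-2 vertex (i,j) with neighbours (a,b),(c,d)
  ⊎ (Σ ℕ λ i → Σ ℕ λ j → Σ ℕ λ a → Σ ℕ λ b → Σ ℕ λ c → Σ ℕ λ d →
       deg n i j ≡ 2 × GridAdj n i j a b × GridAdj n i j c d ×
       ¬ (a ≡ c × b ≡ d) × Port n a b i j x × Port n c d i j y)
  ⊎ CycE n x y

T : ℕ → Graph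
T n = record { V = TV n ; E = λ x y → TR n x y ⊎ TR n y x }

-- Call a graph grid-like of order N if it has N connected "rows" and N connected "columns",
-- every row meeting every column, with no edge between two different rows or two different
-- columns. This survives isomorphism and subdivision (the new vertex sits where one end of
-- the subdivided edge does), and T_m is grid-like of order N for m = 3N + 3, using every
-- third row and column of the grid.
--
-- A graph of clique-width k is never grid-like of order N > 2k. Take a minimal
-- subexpression t of a k-expression whose vertices contain a whole row. Then they contain a
-- whole column too: otherwise each column has an edge leaving t, and edges leaving t at
-- vertices of equal label reach the same vertices, hence the same column. So every row
-- meets t, and either leaves t along an edge or lies in t. In the latter case t is a single
-- vertex, lying on at most one row, or a union neither of whose operands contains a row,
-- so the row leaves the left operand along an edge. Labelling each row by the label of
-- that edge's endpoint, in t or in the left operand, distinguishes N rows by 2k labels.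

module Submission where

open import Defs
open import Data.Bool as Bool using (Bool; true; false; if_then_else_)
open import Data.Bool.Properties using (¬-not; not-¬)
open import Data.Empty using (⊥; ⊥-elim)
open import Data.Fin as Fin using (Fin; toℕ)
import Data.Fin.Properties as Finₚ
open import Data.Maybe using (Maybe; just; nothing; is-just)
open import Data.Nat using (ℕ; zero; suc; _+_; _*_; _≤_; _<_; _∸_; z≤n; s≤s; _≤?_)
open import Data.Nat.Properties renaming (_≟_ to _≟ℕ_)
open import Data.Product
open import Data.Sum using (_⊎_; inj₁; inj₂)
import Data.Sum.Properties as Sumₚ
open import Data.Unit using (⊤; tt)
import Data.Unit.Properties as Unitₚ
open import Function using (_∘_)
open import Function.Bundles using (Inverse; Equivalence)
open import Relation.Binary.Definitions using (DecidableEquality)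
open import Relation.Nullary
open import Relation.Nullary.Decidable using (⌊_⌋; _×-dec_)
open import Relation.Unary using (Decidable)
open import Relation.Binary.PropositionalEquality

-- Connectivity

CrossingEdge : (G : Graph) → (V G → Set) → (V G → Bool) → Set
CrossingEdge G S P = ∃₂ λ a b → S a × S b × E G a b × P a ≡ true × P b ≡ false

CutConnected : (G : Graph) → (V G → Set) → Set
CutConnected G S = ∀ (P : V G → Bool) x y → S x → S y → P x ≡ true → P y ≡ false →
  CrossingEdge G S P

module _ (G : Graph) (S : V G → Set) where

  data Walk : V G → V G → Set where
    [] : ∀ {x} → Walk x x
    step : ∀ {x y z} → E G x y → S y → Walk y z → Walk x z

module _ {G : Graph} {S : V G → Set} where

  _++ʷ_ : ∀ {x y z} → Walk G S x y → Walk G S y z → Walk G S x z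
  [] ++ʷ w = w
  step e Sy w ++ʷ w′ = step e Sy (w ++ʷ w′)

  reverse : (∀ {a b} → E G a b → E G b a) → ∀ {x y} → S x → Walk G S x y → Walk G S y x
  reverse E-sym Sx [] = []
  reverse E-sym Sx (step e Sy w) = reverse E-sym Sy w ++ʷ step (E-sym e) Sx []

  walk-crosses : (P : V G → Bool) → ∀ {x y} → Walk G S x y → S x → P x ≡ true → P y ≡ false →
    CrossingEdge G S P
  walk-crosses P [] Sx Px Py with () ← trans (sym Px) Py
  walk-crosses P {x} (step {y = y} e Sy w) Sx Px Pz with P y in Py
  ... | false = x , y , Sx , Sy , e , Px , Py
  ... | true = walk-crosses P w Sy Py Pz

  walks⇒cutConnected : (∀ {a b} → E G a b → E G b a) → ∀ b → S b → (∀ x → S x → Walk G S b x) →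
                       CutConnected G S
  walks⇒cutConnected E-sym b Sb walk P x y Sx Sy Px Py with P b in Pb
  ... | true = walk-crosses P (walk y Sy) Sb Pb Py
  ... | false = walk-crosses P (reverse E-sym Sb (walk x Sx)) Sx Px Pb

-- Grid-like graphs

-- Lines are spaced 3 apart because adjacent vertices of T_m differ by up to 2 in a
-- coordinate (at the removed corners); starting at 2 keeps them off the border.
line : ℕ → ℕ
line s = 2 + s * 3

line-injective : ∀ {N} {s s′ : Fin N} → line (toℕ s) ≡ line (toℕ s′) → s ≡ s′
line-injective eq = Finₚ.toℕ-injective (*-cancelʳ-≡ _ _ 3 (+-cancelˡ-≡ 2 _ _ eq))

OnLine : {A : Set} {N : ℕ} → (A → ℕ) → Fin N → A → Set
OnLine pos s x = pos x ≡ line (toℕ s)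

record Lines (N : ℕ) (G : Graph) : Set where
  field
    pos : V G → ℕ
    connected : ∀ (s : Fin N) → CutConnected G (OnLine pos s)
    separated : ∀ {a b} {s s′ : Fin N} → E G a b → OnLine pos s a → OnLine pos s′ b → s ≡ s′

record GridLike (N : ℕ) (G : Graph) : Set where
  field
    -- needed only to recognise the subdivided edge
    _≟_ : DecidableEquality (V G)
    rows cols : Lines N G
    meet : ∀ (s s′ : Fin N) → ∃ λ v → OnLine (Lines.pos rows) s v × OnLine (Lines.pos cols) s′ v

module Transport {G H : Graph} (f : V H → V G) (g : V G → V H)
                 (f∘g : ∀ x → f (g x) ≡ x) (g∘f : ∀ y → g (f y) ≡ y)
                 (g-edge : ∀ {a b} → E G a b → E H (g a) (g b))
                 (f-edge : ∀ {a b} → E H a b → E G (f a) (f b)) where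

  cutConnected : ∀ {S} → CutConnected G S → CutConnected H (S ∘ f)
  cutConnected {S} conn P x y Sx Sy Px Py
    with conn (P ∘ g) (f x) (f y) Sx Sy (trans (cong P (g∘f x)) Px) (trans (cong P (g∘f y)) Py)
  ... | a , b , Sa , Sb , e , Pa , Pb =
    g a , g b , subst S (sym (f∘g a)) Sa , subst S (sym (f∘g b)) Sb , g-edge e , Pa , Pb

  lines : ∀ {N} → Lines N G → Lines N H
  lines L = record
    { pos = pos ∘ f
    ; connected = cutConnected ∘ connected
    ; separated = separated ∘ f-edge
    }
    where open Lines L

  gridLike : ∀ {N} → GridLike N G → GridLike N H
  gridLike grid = record
    { _≟_ = λ x y →
        map′ (λ eq → trans (sym (g∘f x)) (trans (cong g eq) (g∘f y))) (cong f) (f x ≟ f y)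
    ; rows = lines rows
    ; cols = lines cols
    ; meet = λ s s′ → let v , r , c = meet s s′ in
        g v , trans (cong (Lines.pos rows) (f∘g v)) r , trans (cong (Lines.pos cols) (f∘g v)) c
    }
    where open GridLike grid

module _ {G H : Graph} (iso : G ≅ H) where
  open _≅_ iso
  open Inverse bij

  ≅-to-edge : ∀ {a b} → E G a b → E H (to a) (to b)
  ≅-to-edge = Equivalence.to (adj _ _)

  ≅-from-edge : ∀ {a b} → E H a b → E G (from a) (from b)
  ≅-from-edge {a} {b} e =
    Equivalence.from (adj _ _) (subst₂ (E H) (sym (strictlyInverseˡ a)) (sym (strictlyInverseˡ b)) e)

  ≅-gridLike : ∀ {N} → GridLike N G → GridLike N H
  ≅-gridLike =
    Transport.gridLike from to strictlyInverseʳ strictlyInverseˡ ≅-to-edge ≅-from-edge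

  ≅-gridLike⁻ : ∀ {N} → GridLike N H → GridLike N G
  ≅-gridLike⁻ =
    Transport.gridLike to from strictlyInverseˡ strictlyInverseʳ ≅-from-edge ≅-to-edge

module SubdivisionStep {N : ℕ} {G : Graph} (grid : GridLike N G) (u v : V G) (uv : E G u v) where
  open GridLike grid

  G′ : Graph
  G′ = subdivideEdge G u v

  w : V G′
  w = inj₂ tt

  extend : (V G → ℕ) → V G′ → ℕ
  extend pos (inj₁ x) = pos x
  extend pos (inj₂ _) = pos u

  old-edge : ∀ {a b} → E G a b → E G′ (inj₁ a) (inj₁ b) ⊎ ((a ≡ u × b ≡ v) ⊎ (a ≡ v × b ≡ u))
  old-edge {a} {b} e with (a ≟ u ×-dec b ≟ v) | (a ≟ v ×-dec b ≟ u)
  ... | yes uv-edge | _ = inj₂ (inj₁ uv-edge)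
  ... | no _ | yes vu-edge = inj₂ (inj₂ vu-edge)
  ... | no ¬uv | no ¬vu = inj₁ (e , λ { (inj₁ p) → ¬uv p ; (inj₂ q) → ¬vu q })

  module _ (L : Lines N G) where
    open Lines L

    On′ : Fin N → V G′ → Set
    On′ = OnLine (extend pos)

    separated′ : ∀ {a b} {s s′ : Fin N} → E G′ a b → On′ s a → On′ s′ b → s ≡ s′
    separated′ {inj₁ _} {inj₁ _} (e , _) = separated e
    separated′ {inj₁ _} {inj₂ _} (inj₁ refl) p q = line-injective (trans (sym p) q)
    separated′ {inj₁ _} {inj₂ _} (inj₂ refl) p q = sym (separated uv q p)
    separated′ {inj₂ _} {inj₁ _} (inj₁ refl) p q = line-injective (trans (sym p) q)
    separated′ {inj₂ _} {inj₁ _} (inj₂ refl) p q = separated uv p q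

    via-w : ∀ (P : V G′ → Bool) s {a b} → E G′ (inj₁ a) w → E G′ w (inj₁ b) → On′ s w →
            On′ s (inj₁ a) → On′ s (inj₁ b) → P (inj₁ a) ≡ true → P (inj₁ b) ≡ false →
            CrossingEdge G′ (On′ s) P
    via-w P s {a} {b} aw wb Sw Sa Sb Pa Pb with P w in Pw
    ... | true = w , inj₁ b , Sw , Sb , wb , Pw , Pb
    ... | false = inj₁ a , w , Sa , Sw , aw , Pa , Pw

    crossing-old : ∀ (P : V G′ → Bool) s {x y} → On′ s (inj₁ x) → On′ s (inj₁ y) →
                   P (inj₁ x) ≡ true → P (inj₁ y) ≡ false → CrossingEdge G′ (On′ s) P
    crossing-old P s Sx Sy Px Py with connected s (P ∘ inj₁) _ _ Sx Sy Px Py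
    ... | a , b , Sa , Sb , e , Pa , Pb with old-edge e
    ...   | inj₁ e′ = inj₁ a , inj₁ b , Sa , Sb , e′ , Pa , Pb
    ...   | inj₂ (inj₁ (refl , refl)) = via-w P s (inj₁ refl) (inj₂ refl) Sa Sa Sb Pa Pb
    ...   | inj₂ (inj₂ (refl , refl)) = via-w P s (inj₂ refl) (inj₁ refl) Sb Sa Sb Pa Pb

    connected′ : ∀ s → CutConnected G′ (On′ s)
    connected′ s P (inj₁ _) (inj₁ _) Sx Sy Px Py = crossing-old P s Sx Sy Px Py
    connected′ s P (inj₂ _) (inj₁ _) Sw Sy Pw Py with P (inj₁ u) in Pu
    ... | true = crossing-old P s Sw Sy Pu Py
    ... | false = w , inj₁ u , Sw , Sw , inj₁ refl , Pw , Pu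
    connected′ s P (inj₁ _) (inj₂ _) Sx Sw Px Pw with P (inj₁ u) in Pu
    ... | true = inj₁ u , w , Sw , Sw , inj₁ refl , Pu , Pw
    ... | false = crossing-old P s Sx Sw Px Pu
    connected′ s P (inj₂ _) (inj₂ _) _ _ Pw Pw′ with () ← trans (sym Pw) Pw′

    lines′ : Lines N G′
    lines′ = record { pos = extend pos ; connected = connected′ ; separated = separated′ }

  gridLike′ : GridLike N G′
  gridLike′ = record
    { _≟_ = Sumₚ.≡-dec _≟_ Unitₚ._≟_
    ; rows = lines′ rows
    ; cols = lines′ cols
    ; meet = λ s s′ → let v , r , c = meet s s′ in inj₁ v , r , c
    }

subdivision-gridLike : ∀ {N H G} → Subdivision H G → GridLike N G → GridLike N H
subdivision-gridLike (base iso) = ≅-gridLike iso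
subdivision-gridLike (step u v uv sub) grid =
  subdivision-gridLike sub (SubdivisionStep.gridLike′ grid u v uv)

-- Subexpressions of k-expressions

left? : {A B : Set} → Maybe (A ⊎ B) → Maybe A
left? (just (inj₁ x)) = just x
left? _ = nothing

right? : {A B : Set} → Maybe (A ⊎ B) → Maybe B
right? (just (inj₂ y)) = just y
right? _ = nothing

left?-just : {A B : Set} (m : Maybe (A ⊎ B)) {x : A} → left? m ≡ just x → m ≡ just (inj₁ x)
left?-just (just (inj₁ _)) refl = refl

right?-just : {A B : Set} (m : Maybe (A ⊎ B)) {y : B} → right? m ≡ just y → m ≡ just (inj₂ y)
right?-just (just (inj₂ _)) refl = refl

module _ {k : ℕ} where

  Vertex : Expr k → Set
  Vertex e = LV ⟦ e ⟧

  data Context : Set where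
    top : Context
    inL : Context → Expr k → Context
    inR : Expr k → Context → Context
    inρ : Fin k → Fin k → Context → Context
    inη : (i j : Fin k) → i ≢ j → Context → Context

  plug : Context → Expr k → Expr k
  plug top t = t
  plug (inL C e) t = plug C (t ⊕ e)
  plug (inR e C) t = plug C (e ⊕ t)
  plug (inρ i j C) t = plug C (ρ i j t)
  plug (inη i j i≢j C) t = plug C (η i j i≢j t)

  embed : ∀ C t → Vertex t → Vertex (plug C t)
  embed top t x = x
  embed (inL C e) t x = embed C (t ⊕ e) (inj₁ x)
  embed (inR e C) t x = embed C (e ⊕ t) (inj₂ x)
  embed (inρ i j C) t x = embed C (ρ i j t) x
  embed (inη i j i≢j C) t x = embed C (η i j i≢j t) x

  project : ∀ C t → Vertex (plug C t) → Maybe (Vertex t)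
  project top t y = just y
  project (inL C e) t y = left? (project C (t ⊕ e) y)
  project (inR e C) t y = right? (project C (e ⊕ t) y)
  project (inρ i j C) t y = project C (ρ i j t) y
  project (inη i j i≢j C) t y = project C (η i j i≢j t) y

  project-embed : ∀ C t x → project C t (embed C t x) ≡ just x
  project-embed top t x = refl
  project-embed (inL C e) t x rewrite project-embed C (t ⊕ e) (inj₁ x) = refl
  project-embed (inR e C) t x rewrite project-embed C (e ⊕ t) (inj₂ x) = refl
  project-embed (inρ i j C) t x = project-embed C (ρ i j t) x
  project-embed (inη i j i≢j C) t x = project-embed C (η i j i≢j t) x

  embed-project : ∀ C t y {x} → project C t y ≡ just x → embed C t x ≡ y
  embed-project top t y refl = refl
  embed-project (inL C e) t y eq = embed-project C (t ⊕ e) y (left?-just _ eq)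
  embed-project (inR e C) t y eq = embed-project C (e ⊕ t) y (right?-just _ eq)
  embed-project (inρ i j C) t y eq = embed-project C (ρ i j t) y eq
  embed-project (inη i j i≢j C) t y eq = embed-project C (η i j i≢j t) y eq

  inside : ∀ C t → Vertex (plug C t) → Bool
  inside C t y = is-just (project C t y)

  inside-embed : ∀ C t x → inside C t (embed C t x) ≡ true
  inside-embed C t x rewrite project-embed C t x = refl

  inside⇒embed : ∀ C t y → inside C t y ≡ true → ∃ λ x → embed C t x ≡ y
  inside⇒embed C t y inside-y with project C t y in eq
  ... | just x = x , embed-project C t y eq

  inside-left : ∀ C t₁ t₂ y → inside C (t₁ ⊕ t₂) y ≡ true → inside (inR t₁ C) t₂ y ≡ false →
                inside (inL C t₂) t₁ y ≡ true
  inside-left C t₁ t₂ y _ _ with project C (t₁ ⊕ t₂) y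
  ... | just (inj₁ _) = refl

  embed-edge : ∀ C t {x x′} → LE ⟦ t ⟧ x x′ → LE ⟦ plug C t ⟧ (embed C t x) (embed C t x′)
  embed-edge top t e = e
  embed-edge (inL C e′) t e = embed-edge C (t ⊕ e′) e
  embed-edge (inR e′ C) t e = embed-edge C (e′ ⊕ t) e
  embed-edge (inρ i j C) t e = embed-edge C (ρ i j t) e
  embed-edge (inη i j i≢j C) t e = embed-edge C (η i j i≢j t) (inj₁ e)

  -- Seen from outside a subexpression, its vertices differ only by their labels.
  outer-neighbour : ∀ C t {x x′} → lab ⟦ t ⟧ x ≡ lab ⟦ t ⟧ x′ → ∀ {y} →
    LE ⟦ plug C t ⟧ (embed C t x′) y →
    (∃ λ z → y ≡ embed C t z × LE ⟦ t ⟧ x′ z) ⊎ LE ⟦ plug C t ⟧ (embed C t x) y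
  outer-neighbour top t _ e = inj₁ (_ , refl , e)
  outer-neighbour (inL C e′) t eq e with outer-neighbour C (t ⊕ e′) eq e
  ... | inj₁ (inj₁ z , refl , e″) = inj₁ (z , refl , e″)
  ... | inj₂ e″ = inj₂ e″
  outer-neighbour (inR e′ C) t eq e with outer-neighbour C (e′ ⊕ t) eq e
  ... | inj₁ (inj₂ z , refl , e″) = inj₁ (z , refl , e″)
  ... | inj₂ e″ = inj₂ e″
  outer-neighbour (inρ i j C) t eq e =
    outer-neighbour C (ρ i j t) (cong (λ l → if ⌊ l Fin.≟ i ⌋ then j else l) eq) e
  outer-neighbour (inη i j i≢j C) t {x} eq e with outer-neighbour C (η i j i≢j t) eq e
  ... | inj₂ e″ = inj₂ e″
  ... | inj₁ (z , refl , inj₁ e″) = inj₁ (z , refl , e″)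
  ... | inj₁ (z , refl , inj₂ (inj₁ (x′i , zj))) =
    inj₂ (embed-edge C (η i j i≢j t) (inj₂ (inj₁ (trans eq x′i , zj))))
  ... | inj₁ (z , refl , inj₂ (inj₂ (x′j , zi))) =
    inj₂ (embed-edge C (η i j i≢j t) (inj₂ (inj₂ (trans eq x′j , zi))))

  any-vertex? : ∀ (e : Expr k) {P : Vertex e → Set} → Decidable P → Dec (∃ P)
  any-vertex? (vert _) P? = map′ (tt ,_) proj₂ (P? tt)
  any-vertex? (e₁ ⊕ e₂) P? with any-vertex? e₁ (P? ∘ inj₁) | any-vertex? e₂ (P? ∘ inj₂)
  ... | yes (x , p) | _ = yes (inj₁ x , p)
  ... | no _ | yes (x , p) = yes (inj₂ x , p)
  ... | no ¬₁ | no ¬₂ = no λ { (inj₁ x , p) → ¬₁ (x , p) ; (inj₂ x , p) → ¬₂ (x , p) }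
  any-vertex? (ρ _ _ e) = any-vertex? e
  any-vertex? (η _ _ _ e) = any-vertex? e

-- Graphs defined by k-expressions are not grid-like

join-injective : ∀ m n {x y : Fin m ⊎ Fin n} → Fin.join m n x ≡ Fin.join m n y → x ≡ y
join-injective m n {x} {y} eq =
  trans (sym (Finₚ.splitAt-join m n x)) (trans (cong (Fin.splitAt m) eq) (Finₚ.splitAt-join m n y))

module _ {k N : ℕ} (C : Context) (t : Expr k) (grid : GridLike N (graphOf (plug C t))) where
  open GridLike grid
  open Lines

  Covered : Lines N (graphOf (plug C t)) → Fin N → Set
  Covered L s = ∀ y → OnLine (pos L) s y → inside C t y ≡ true

  CoveredRow : Fin N → Set
  CoveredRow = Covered rows

  record Boundary (L : Lines N (graphOf (plug C t))) (s : Fin N) : Set where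
    field
      inner : Vertex t
      outer : Vertex (plug C t)
      inner-on : OnLine (pos L) s (embed C t inner)
      outer-on : OnLine (pos L) s outer
      crossing : LE ⟦ plug C t ⟧ (embed C t inner) outer
      outer-outside : inside C t outer ≡ false

    label : Fin k
    label = lab ⟦ t ⟧ inner

  open Boundary

  boundary : ∀ L s {x y} → OnLine (pos L) s x → OnLine (pos L) s y →
             inside C t x ≡ true → inside C t y ≡ false → Boundary L s
  boundary L s {x} {y} on-x on-y in-x out-y with connected L s (inside C t) x y on-x on-y in-x out-y
  ... | a , b , on-a , on-b , e , in-a , out-b with inside⇒embed C t a in-a
  ...   | a′ , refl = record
    { inner = a′ ; outer = b ; inner-on = on-a ; outer-on = on-b
    ; crossing = e ; outer-outside = out-b }

  boundary-label-injective : ∀ L {s s′} (b : Boundary L s) (b′ : Boundary L s′) →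
                             label b ≡ label b′ → s ≡ s′
  boundary-label-injective L b b′ eq with outer-neighbour C t eq (crossing b′)
  ... | inj₁ (z , refl , _) with () ← trans (sym (inside-embed C t z)) (outer-outside b′)
  ... | inj₂ e = separated L e (inner-on b) (outer-on b′)

  covered-or-escapes : ∀ L s → Covered L s ⊎ ∃ λ y → OnLine (pos L) s y × inside C t y ≡ false
  covered-or-escapes L s
    with any-vertex? (plug C t) (λ y → pos L y ≟ℕ line (toℕ s) ×-dec inside C t y Bool.≟ false)
  ... | yes escape = inj₂ escape
  ... | no ¬escape = inj₁ λ y on-y → ¬-not λ out-y → ¬escape (y , on-y , out-y)

  covered? : ∀ L s → Dec (Covered L s)
  covered? L s with covered-or-escapes L s
  ... | inj₁ c = yes c
  ... | inj₂ (y , on-y , out-y) = no λ c → not-¬ (c y on-y) out-y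

  coveredRow? : ∀ s → Dec (CoveredRow s)
  coveredRow? = covered? rows

  covered-or-boundary : ∀ L s {x} → OnLine (pos L) s x → inside C t x ≡ true →
                        Covered L s ⊎ Boundary L s
  covered-or-boundary L s on-x in-x with covered-or-escapes L s
  ... | inj₁ c = inj₁ c
  ... | inj₂ (y , on-y , out-y) = inj₂ (boundary L s on-x on-y in-x out-y)

  covered-row⇒covered-col : k < N → ∀ s₀ → CoveredRow s₀ → ∃ (Covered cols)
  covered-row⇒covered-col k<N s₀ covered with Finₚ.any? (covered? cols)
  ... | yes c = c
  ... | no ¬c = ⊥-elim (Finₚ.<⇒notInjective k<N λ {j} {j′} →
                  boundary-label-injective cols (boundary-at j) (boundary-at j′))
    where
      boundary-at : ∀ j → Boundary cols j
      boundary-at j with meet s₀ j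
      ... | v , r , c with covered-or-boundary cols j c (covered v r)
      ...   | inj₁ cov = ⊥-elim (¬c (j , cov))
      ...   | inj₂ b = b

  CoveredRowLabelling : Set
  CoveredRowLabelling =
    Σ (∀ s → CoveredRow s → Fin k) λ h → ∀ {s s′} c c′ → h s c ≡ h s′ c′ → s ≡ s′

  ¬coveredRowLabelling : k + k < N → ∀ j₀ → Covered cols j₀ → ¬ CoveredRowLabelling
  ¬coveredRowLabelling 2k<N j₀ covered (h , h-injective) =
    Finₚ.<⇒notInjective 2k<N λ {s} {s′} → tag-injective (kind s) (kind s′) ∘ join-injective k k
    where
      kind : ∀ s → Boundary rows s ⊎ CoveredRow s
      kind s with meet s j₀
      ... | v , r , c with covered-or-boundary rows s r (covered v c)
      ...   | inj₁ cov = inj₂ cov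
      ...   | inj₂ b = inj₁ b

      tag : ∀ {s} → Boundary rows s ⊎ CoveredRow s → Fin k ⊎ Fin k
      tag (inj₁ b) = inj₁ (label b)
      tag {s} (inj₂ c) = inj₂ (h s c)

      tag-injective : ∀ {s s′} (κ : Boundary rows s ⊎ CoveredRow s)
                      (κ′ : Boundary rows s′ ⊎ CoveredRow s′) → tag κ ≡ tag κ′ → s ≡ s′
      tag-injective (inj₁ b) (inj₁ b′) eq =
        boundary-label-injective rows b b′ (Sumₚ.inj₁-injective eq)
      tag-injective (inj₂ c) (inj₂ c′) eq = h-injective c c′ (Sumₚ.inj₂-injective eq)

module _ {k N : ℕ} (2k<N : k + k < N) where

  k<N : k < N
  k<N = ≤-trans (s≤s (m≤m+n k k)) 2k<N

  no-covered-row : ∀ C (t : Expr k) (grid : GridLike N (graphOf (plug C t))) s₀ →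
                   CoveredRow C t grid s₀ → ⊥
  no-covered-row C (vert i) grid s₀ covered
    with covered-row⇒covered-col C (vert i) grid k<N s₀ covered
  ... | j₀ , col-covered =
    ¬coveredRowLabelling C (vert i) grid 2k<N j₀ col-covered ((λ _ _ → i) , one-row)
    where
      open GridLike grid

      -- Every row meets the covered column j₀ in the single vertex of vert i.
      one-row : ∀ {s s′} → CoveredRow C (vert i) grid s → CoveredRow C (vert i) grid s′ →
                i ≡ i → s ≡ s′
      one-row {s} {s′} _ _ _ with meet s j₀ | meet s′ j₀
      ... | v , r , c | v′ , r′ , c′
        with inside⇒embed C (vert i) v (col-covered v c)
           | inside⇒embed C (vert i) v′ (col-covered v′ c′)
      ...   | tt , refl | tt , refl = line-injective (trans (sym r) r′)
  no-covered-row C (t₁ ⊕ t₂) grid s₀ covered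
    with Finₚ.any? (coveredRow? (inL C t₂) t₁ grid) | Finₚ.any? (coveredRow? (inR t₁ C) t₂ grid)
  ... | yes (s , c) | _ = no-covered-row (inL C t₂) t₁ grid s c
  ... | no _ | yes (s , c) = no-covered-row (inR t₁ C) t₂ grid s c
  ... | no ¬c₁ | no ¬c₂ with covered-row⇒covered-col C (t₁ ⊕ t₂) grid k<N s₀ covered
  ...   | j₀ , col-covered =
    ¬coveredRowLabelling C (t₁ ⊕ t₂) grid 2k<N j₀ col-covered
      ((λ s → label ∘ split s) , split-injective)
    where
      open GridLike grid
      open Boundary

      split : ∀ s → CoveredRow C (t₁ ⊕ t₂) grid s → Boundary (inL C t₂) t₁ grid rows s
      split s c with covered-or-escapes (inL C t₂) t₁ grid rows s
                   | covered-or-escapes (inR t₁ C) t₂ grid rows s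
      ... | inj₁ c₁ | _ = ⊥-elim (¬c₁ (s , c₁))
      ... | inj₂ _ | inj₁ c₂ = ⊥-elim (¬c₂ (s , c₂))
      ... | inj₂ (y₁ , on₁ , out₁) | inj₂ (y₂ , on₂ , out₂) =
        boundary (inL C t₂) t₁ grid rows s on₂ on₁ (inside-left C t₁ t₂ y₂ (c y₂ on₂) out₂) out₁

      split-injective : ∀ {s s′} c c′ → label (split s c) ≡ label (split s′ c′) → s ≡ s′
      split-injective c c′ =
        boundary-label-injective (inL C t₂) t₁ grid rows (split _ c) (split _ c′)
  no-covered-row C (ρ i j t) grid = no-covered-row (inρ i j C) t grid
  no-covered-row C (η i j i≢j t) grid = no-covered-row (inη i j i≢j C) t grid

  no-gridLike : (e : Expr k) → ¬ GridLike N (graphOf e)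
  no-gridLike e grid =
    no-covered-row top e grid (Fin.fromℕ< (≤-trans (s≤s z≤n) 2k<N)) (λ _ _ → refl)

-- T_m is grid-like

*3≤2+*3⇒≤ : ∀ a b → a * 3 ≤ 2 + b * 3 → a ≤ b
*3≤2+*3⇒≤ zero b _ = z≤n
*3≤2+*3⇒≤ (suc a) (suc b) (s≤s (s≤s (s≤s h))) = s≤s (*3≤2+*3⇒≤ a b h)

Near : ℕ → ℕ → ℕ → Set
Near d a b = a ≤ d + b × b ≤ d + a

near-lines : ∀ {N} {s s′ : Fin N} → Near 2 (line (toℕ s)) (line (toℕ s′)) → s ≡ s′
near-lines (s≤s (s≤s h) , s≤s (s≤s h′)) =
  Finₚ.toℕ-injective (≤-antisym (*3≤2+*3⇒≤ _ _ h) (*3≤2+*3⇒≤ _ _ h′))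

near-weaken : ∀ {a b} → Near 1 a b → Near 2 a b
near-weaken (p , q) = m≤n⇒m≤1+n p , m≤n⇒m≤1+n q

near-via : ∀ {i a c} → Near 1 i a → Near 1 i c → Near 2 a c
near-via (i≤1+a , a≤1+i) (i≤1+c , c≤1+i) = ≤-trans a≤1+i (s≤s i≤1+c) , ≤-trans c≤1+i (s≤s i≤1+a)

module TGeometry (m : ℕ) where

  Interior : ℕ → Set
  Interior i = 2 ≤ i × suc i ≤ m

  inGridᵇ-true : ∀ {a b} → InGrid m a b → inGridᵇ m a b ≡ true
  inGridᵇ-true {a} {b} ((p₁ , p₂) , (p₃ , p₄)) with 1 ≤? a | a ≤? m | 1 ≤? b | b ≤? m
  ... | yes _ | yes _ | yes _ | yes _ = refl
  ... | no ¬p₁ | _ | _ | _ = ⊥-elim (¬p₁ p₁)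
  ... | yes _ | no ¬p₂ | _ | _ = ⊥-elim (¬p₂ p₂)
  ... | yes _ | yes _ | no ¬p₃ | _ = ⊥-elim (¬p₃ p₃)
  ... | yes _ | yes _ | yes _ | no ¬p₄ = ⊥-elim (¬p₄ p₄)

  inGridᵇ-false : ∀ {a b} → ¬ InGrid m a b → inGridᵇ m a b ≡ false
  inGridᵇ-false {a} {b} ¬in with 1 ≤? a | a ≤? m | 1 ≤? b | b ≤? m
  ... | yes p₁ | yes p₂ | yes p₃ | yes p₄ = ⊥-elim (¬in ((p₁ , p₂) , (p₃ , p₄)))
  ... | no _ | _ | _ | _ = refl
  ... | yes _ | no _ | _ | _ = refl
  ... | yes _ | yes _ | no _ | _ = refl
  ... | yes _ | yes _ | yes _ | no _ = refl

  deg-from : ∀ i j {b₁ b₂ b₃ b₄} → inGridᵇ m (i ∸ 1) j ≡ b₁ → inGridᵇ m i (suc j) ≡ b₂ →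
             inGridᵇ m (suc i) j ≡ b₃ → inGridᵇ m i (j ∸ 1) ≡ b₄ →
             deg m i j ≡ b2n b₁ + b2n b₂ + b2n b₃ + b2n b₄
  deg-from i j refl refl refl refl = refl

  interior-bounds : ∀ {i} → Interior i → 1 ≤ i × i ≤ m
  interior-bounds (p , q) = ≤-trans (s≤s z≤n) p , ≤-trans (n≤1+n _) q

  pred-bounds : ∀ {i} → Interior i → 1 ≤ i ∸ 1 × i ∸ 1 ≤ m
  pred-bounds {suc (suc i)} (s≤s (s≤s _) , q) = s≤s z≤n , ≤-trans (n≤1+n _) (≤-trans (n≤1+n _) q)

  succ-bounds : ∀ {i} → Interior i → 1 ≤ suc i × suc i ≤ m
  succ-bounds (_ , q) = s≤s z≤n , q

  deg-interior : ∀ {i j} → Interior i → Interior j → deg m i j ≡ 4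
  deg-interior {i} {j} ii jj = deg-from i j
    (inGridᵇ-true (pred-bounds ii , interior-bounds jj))
    (inGridᵇ-true (interior-bounds ii , succ-bounds jj))
    (inGridᵇ-true (succ-bounds ii , interior-bounds jj))
    (inGridᵇ-true (interior-bounds ii , pred-bounds jj))

  row col : TV m → ℕ
  row (keep i _ _ _) = i
  row (cyc i _ _ _ _) = i
  col (keep _ j _ _) = j
  col (cyc _ j _ _ _) = j

  dir-near : ∀ d {i j i′ j′} → Dir d i j i′ j′ → Near 1 i i′ × Near 1 j j′
  dir-near Fin.zero (refl , refl) = (≤-refl , m≤n+m _ 2) , (n≤1+n _ , n≤1+n _)
  dir-near (Fin.suc Fin.zero) (refl , refl) = (n≤1+n _ , n≤1+n _) , (m≤n+m _ 2 , ≤-refl)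
  dir-near (Fin.suc (Fin.suc Fin.zero)) (refl , refl) = (m≤n+m _ 2 , ≤-refl) , (n≤1+n _ , n≤1+n _)
  dir-near (Fin.suc (Fin.suc (Fin.suc Fin.zero))) (refl , refl) =
    (n≤1+n _ , n≤1+n _) , (≤-refl , m≤n+m _ 2)

  port-position : ∀ {i j i′ j′} x → Port m i j i′ j′ x → row x ≡ i × col x ≡ j
  port-position (keep _ _ _ _) p = p
  port-position (cyc _ _ _ _ _) (p , _) = p

  generator-near : ∀ x y → TR m x y → Near 2 (row x) (row y) × Near 2 (col x) (col y)
  generator-near x y (inj₁ (_ , _ , _ , _ , (_ , _ , d , dir) , px , py))
    with port-position x px | port-position y py | dir-near d dir
  ... | refl , refl | refl , refl | near-r , near-c = near-weaken near-r , near-weaken near-c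
  generator-near x y
    (inj₂ (inj₁ (_ , _ , _ , _ , _ , _ , _ , (_ , _ , d₁ , dir₁) , (_ , _ , d₂ , dir₂) , _ , px , py)))
    with port-position x px | port-position y py | dir-near d₁ dir₁ | dir-near d₂ dir₂
  ... | refl , refl | refl , refl | near-r₁ , near-c₁ | near-r₂ , near-c₂ =
    near-via near-r₁ near-r₂ , near-via near-c₁ near-c₂
  generator-near (cyc _ _ _ _ _) (cyc _ _ _ _ _) (inj₂ (inj₂ ((refl , refl) , _))) =
    (m≤n+m _ 2 , m≤n+m _ 2) , (m≤n+m _ 2 , m≤n+m _ 2)

  edge-near : ∀ {x y} → E (T m) x y → Near 2 (row x) (row y) × Near 2 (col x) (col y)
  edge-near (inj₁ g) = generator-near _ _ g
  edge-near (inj₂ g) with generator-near _ _ g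
  ... | (p , q) , (p′ , q′) = (q , p) , (q′ , p′)

  T-sym : ∀ {x y} → E (T m) x y → E (T m) y x
  T-sym (inj₁ g) = inj₂ g
  T-sym (inj₂ g) = inj₁ g

  InGrid-irrelevant : ∀ {i j} (p q : InGrid m i j) → p ≡ q
  InGrid-irrelevant ((a , b) , (c , d)) ((a′ , b′) , (c′ , d′))
    rewrite ≤-irrelevant a a′ | ≤-irrelevant b b′ | ≤-irrelevant c c′ | ≤-irrelevant d d′ = refl

  keep-irrelevant : ∀ {i j p p′ q q′} → keep i j p q ≡ keep i j p′ q′
  keep-irrelevant {p = p} {p′} {q} {q′} rewrite InGrid-irrelevant p p′ | ≡-irrelevant q q′ = refl

  cyc-irrelevant : ∀ {i j p p′ q q′ d} → cyc i j p q d ≡ cyc i j p′ q′ d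
  cyc-irrelevant {p = p} {p′} {q} {q′} rewrite InGrid-irrelevant p p′ | ≡-irrelevant q q′ = refl

  _≟ᵀ_ : DecidableEquality (TV m)
  keep i j _ _ ≟ᵀ keep i′ j′ _ _ with i ≟ℕ i′ | j ≟ℕ j′
  ... | yes refl | yes refl = yes keep-irrelevant
  ... | no i≢i′ | _ = no λ { refl → i≢i′ refl }
  ... | yes _ | no j≢j′ = no λ { refl → j≢j′ refl }
  keep _ _ _ _ ≟ᵀ cyc _ _ _ _ _ = no λ ()
  cyc _ _ _ _ _ ≟ᵀ keep _ _ _ _ = no λ ()
  cyc i j _ _ d ≟ᵀ cyc i′ j′ _ _ d′ with i ≟ℕ i′ | j ≟ℕ j′ | d Fin.≟ d′
  ... | yes refl | yes refl | yes refl = yes cyc-irrelevant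
  ... | no i≢i′ | _ | _ = no λ { refl → i≢i′ refl }
  ... | yes _ | no j≢j′ | _ = no λ { refl → j≢j′ refl }
  ... | yes _ | yes _ | no d≢d′ = no λ { refl → d≢d′ refl }

module TLines (m′ : ℕ) (2≤m′ : 2 ≤ m′) where

  m : ℕ
  m = suc m′

  open TGeometry m

  north east south west : Fin 4
  north = Fin.zero
  east = Fin.suc Fin.zero
  south = Fin.suc (Fin.suc Fin.zero)
  west = Fin.suc (Fin.suc (Fin.suc Fin.zero))

  1≤m′ : 1 ≤ m′
  1≤m′ = ≤-trans (s≤s z≤n) 2≤m′

  first : 1 ≤ 1 × 1 ≤ m
  first = s≤s z≤n , s≤s z≤n

  second : 1 ≤ 2 × 2 ≤ m
  second = s≤s z≤n , s≤s 1≤m′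

  last : 1 ≤ m × m ≤ m
  last = s≤s z≤n , ≤-refl

  next-to-last : 1 ≤ m′ × m′ ≤ m
  next-to-last = 1≤m′ , n≤1+n _

  interior-m′ : Interior m′
  interior-m′ = 2≤m′ , ≤-refl

  interior-pred : ∀ {j} → Interior (suc (suc (suc j))) → Interior (suc (suc j))
  interior-pred (_ , q) = s≤s (s≤s z≤n) , ≤-trans (n≤1+n _) q

  interior-of : ∀ {b} → 1 ≤ b × b ≤ m → b ≢ 1 → b ≢ m → Interior b
  interior-of {suc zero} _ b≢1 _ = ⊥-elim (b≢1 refl)
  interior-of {suc (suc b)} (_ , b≤m) _ b≢m = s≤s (s≤s z≤n) , ≤∧≢⇒< b≤m b≢m

  outside-0 : ∀ {i} → ¬ InGrid m i 0
  outside-0 (_ , (() , _))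

  outside-0′ : ∀ {j} → ¬ InGrid m 0 j
  outside-0′ ((() , _) , _)

  outside-m+1 : ∀ {i} → ¬ InGrid m i (suc m)
  outside-m+1 (_ , (_ , p)) = <-irrefl refl p

  outside-m+1′ : ∀ {j} → ¬ InGrid m (suc m) j
  outside-m+1′ ((_ , p) , _) = <-irrefl refl p

  deg-west : ∀ {i} → Interior i → deg m i 1 ≡ 3
  deg-west {i} ii = deg-from i 1
    (inGridᵇ-true (pred-bounds ii , first)) (inGridᵇ-true (interior-bounds ii , second))
    (inGridᵇ-true (succ-bounds ii , first)) (inGridᵇ-false (outside-0 {i}))

  deg-east : ∀ {i} → Interior i → deg m i m ≡ 3
  deg-east {i} ii = deg-from i m
    (inGridᵇ-true (pred-bounds ii , last)) (inGridᵇ-false (outside-m+1 {i}))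
    (inGridᵇ-true (succ-bounds ii , last)) (inGridᵇ-true (interior-bounds ii , next-to-last))

  deg-north : ∀ {j} → Interior j → deg m 1 j ≡ 3
  deg-north {j} jj = deg-from 1 j
    (inGridᵇ-false (outside-0′ {j})) (inGridᵇ-true (first , succ-bounds jj))
    (inGridᵇ-true (second , interior-bounds jj)) (inGridᵇ-true (first , pred-bounds jj))

  deg-south : ∀ {j} → Interior j → deg m m j ≡ 3
  deg-south {j} jj = deg-from m j
    (inGridᵇ-true (next-to-last , interior-bounds jj)) (inGridᵇ-true (last , succ-bounds jj))
    (inGridᵇ-false (outside-m+1′ {j})) (inGridᵇ-true (last , pred-bounds jj))

  4≢3 : 4 ≢ 3
  4≢3 ()

  cycle-vertex : ∀ {i j} → Interior i → Interior j → Fin 4 → TV m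
  cycle-vertex ii jj d = cyc _ _ (interior-bounds ii , interior-bounds jj) (deg-interior ii jj) d

  grid-edge : ∀ {i j i′ j′} x y d → InGrid m i j → InGrid m i′ j′ → Dir d i j i′ j′ →
              Port m i j i′ j′ x → Port m i′ j′ i j y → E (T m) x y
  grid-edge x y d p p′ dir px py = inj₁ (inj₁ (_ , _ , _ , _ , (p , p′ , d , dir) , px , py))

  cycle-edge : ∀ {i j} (ii : Interior i) (jj : Interior j) d →
               E (T m) (cycle-vertex ii jj d) (cycle-vertex ii jj (next d))
  cycle-edge _ _ _ = inj₁ (inj₂ (inj₂ ((refl , refl) , refl)))

  module RowWalks (i : ℕ) (ii : Interior i) where

    OnRow : TV m → Set
    OnRow x = row x ≡ i

    RowWalk : TV m → TV m → Set
    RowWalk = Walk (T m) OnRow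

    west-end : TV m
    west-end = keep i 1 (interior-bounds ii , first) (deg-west ii)

    east-end : TV m
    east-end = keep i m (interior-bounds ii , last) (deg-east ii)

    turn : ∀ {j} (jj : Interior j) d → RowWalk (cycle-vertex ii jj d) (cycle-vertex ii jj (next d))
    turn jj d = step (cycle-edge ii jj d) refl []

    to-west-port : ∀ j (jj : Interior j) → RowWalk west-end (cycle-vertex ii jj west)
    to-west-port (suc zero) (s≤s () , _)
    to-west-port (suc (suc zero)) jj =
      step (grid-edge west-end (cycle-vertex ii jj west) east (interior-bounds ii , first)
              (interior-bounds ii , second) (refl , refl) (refl , refl) ((refl , refl) , (refl , refl)))
           refl []
    to-west-port (suc (suc (suc j))) jj =
      let jj′ = interior-pred jj in
      to-west-port (suc (suc j)) jj′ ++ʷ (turn jj′ west ++ʷ (turn jj′ north ++ʷ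
      step (grid-edge (cycle-vertex ii jj′ east) (cycle-vertex ii jj west) east
              (interior-bounds ii , interior-bounds jj′) (interior-bounds ii , interior-bounds jj)
              (refl , refl) ((refl , refl) , (refl , refl)) ((refl , refl) , (refl , refl)))
           refl []))

    to-cycle : ∀ j (jj : Interior j) d → RowWalk west-end (cycle-vertex ii jj d)
    to-cycle j jj (Fin.suc (Fin.suc (Fin.suc Fin.zero))) = to-west-port j jj
    to-cycle j jj Fin.zero = to-west-port j jj ++ʷ turn jj west
    to-cycle j jj (Fin.suc Fin.zero) = to-west-port j jj ++ʷ (turn jj west ++ʷ turn jj north)
    to-cycle j jj (Fin.suc (Fin.suc Fin.zero)) =
      to-west-port j jj ++ʷ (turn jj west ++ʷ (turn jj north ++ʷ turn jj east))

    to-east-end : RowWalk west-end east-end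
    to-east-end = to-cycle m′ interior-m′ east ++ʷ
      step (grid-edge (cycle-vertex ii interior-m′ east) east-end east
              (interior-bounds ii , interior-bounds interior-m′) (interior-bounds ii , last)
              (refl , refl) ((refl , refl) , (refl , refl)) (refl , refl))
           refl []

    walk : ∀ x → OnRow x → RowWalk west-end x
    walk (keep _ b p q) refl with b ≟ℕ 1 | b ≟ℕ m
    ... | yes refl | _ = subst (RowWalk west-end) keep-irrelevant []
    ... | no _ | yes refl = subst (RowWalk west-end) keep-irrelevant to-east-end
    ... | no b≢1 | no b≢m =
      ⊥-elim (4≢3 (trans (sym (deg-interior ii (interior-of (proj₂ p) b≢1 b≢m))) q))
    walk (cyc _ b p q d) refl with b ≟ℕ 1 | b ≟ℕ m
    ... | yes refl | _ = ⊥-elim (4≢3 (trans (sym q) (deg-west ii)))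
    ... | no _ | yes refl = ⊥-elim (4≢3 (trans (sym q) (deg-east ii)))
    ... | no b≢1 | no b≢m =
      subst (RowWalk west-end) cyc-irrelevant (to-cycle b (interior-of (proj₂ p) b≢1 b≢m) d)

    row-connected : CutConnected (T m) OnRow
    row-connected = walks⇒cutConnected T-sym west-end refl walk

  module ColumnWalks (j : ℕ) (jj : Interior j) where

    OnCol : TV m → Set
    OnCol x = col x ≡ j

    ColWalk : TV m → TV m → Set
    ColWalk = Walk (T m) OnCol

    north-end : TV m
    north-end = keep 1 j (first , interior-bounds jj) (deg-north jj)

    south-end : TV m
    south-end = keep m j (last , interior-bounds jj) (deg-south jj)

    turn : ∀ {i} (ii : Interior i) d → ColWalk (cycle-vertex ii jj d) (cycle-vertex ii jj (next d))
    turn ii d = step (cycle-edge ii jj d) refl []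

    to-north-port : ∀ i (ii : Interior i) → ColWalk north-end (cycle-vertex ii jj north)
    to-north-port (suc zero) (s≤s () , _)
    to-north-port (suc (suc zero)) ii =
      step (grid-edge north-end (cycle-vertex ii jj north) south (first , interior-bounds jj)
              (second , interior-bounds jj) (refl , refl) (refl , refl) ((refl , refl) , (refl , refl)))
           refl []
    to-north-port (suc (suc (suc i))) ii =
      let ii′ = interior-pred ii in
      to-north-port (suc (suc i)) ii′ ++ʷ (turn ii′ north ++ʷ (turn ii′ east ++ʷ
      step (grid-edge (cycle-vertex ii′ jj south) (cycle-vertex ii jj north) south
              (interior-bounds ii′ , interior-bounds jj) (interior-bounds ii , interior-bounds jj)
              (refl , refl) ((refl , refl) , (refl , refl)) ((refl , refl) , (refl , refl)))
           refl []))

    to-cycle : ∀ i (ii : Interior i) d → ColWalk north-end (cycle-vertex ii jj d)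
    to-cycle i ii Fin.zero = to-north-port i ii
    to-cycle i ii (Fin.suc Fin.zero) = to-north-port i ii ++ʷ turn ii north
    to-cycle i ii (Fin.suc (Fin.suc Fin.zero)) = to-north-port i ii ++ʷ (turn ii north ++ʷ turn ii east)
    to-cycle i ii (Fin.suc (Fin.suc (Fin.suc Fin.zero))) =
      to-north-port i ii ++ʷ (turn ii north ++ʷ (turn ii east ++ʷ turn ii south))

    to-south-end : ColWalk north-end south-end
    to-south-end = to-cycle m′ interior-m′ south ++ʷ
      step (grid-edge (cycle-vertex interior-m′ jj south) south-end south
              (interior-bounds interior-m′ , interior-bounds jj) (last , interior-bounds jj)
              (refl , refl) ((refl , refl) , (refl , refl)) (refl , refl))
           refl []

    walk : ∀ x → OnCol x → ColWalk north-end x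
    walk (keep a _ p q) refl with a ≟ℕ 1 | a ≟ℕ m
    ... | yes refl | _ = subst (ColWalk north-end) keep-irrelevant []
    ... | no _ | yes refl = subst (ColWalk north-end) keep-irrelevant to-south-end
    ... | no a≢1 | no a≢m =
      ⊥-elim (4≢3 (trans (sym (deg-interior (interior-of (proj₁ p) a≢1 a≢m) jj)) q))
    walk (cyc a _ p q d) refl with a ≟ℕ 1 | a ≟ℕ m
    ... | yes refl | _ = ⊥-elim (4≢3 (trans (sym q) (deg-north jj)))
    ... | no _ | yes refl = ⊥-elim (4≢3 (trans (sym q) (deg-south jj)))
    ... | no a≢1 | no a≢m =
      subst (ColWalk north-end) cyc-irrelevant (to-cycle a (interior-of (proj₁ p) a≢1 a≢m) d)

    col-connected : CutConnected (T m) OnCol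
    col-connected = walks⇒cutConnected T-sym north-end refl walk

T-gridLike : ∀ N → GridLike N (T (3 + N * 3))
T-gridLike N = record
  { _≟_ = _≟ᵀ_
  ; rows = record
    { pos = row
    ; connected = λ s → RowWalks.row-connected _ (line-interior s)
    ; separated = λ e p q → near-lines (subst₂ (Near 2) p q (proj₁ (edge-near e)))
    }
  ; cols = record
    { pos = col
    ; connected = λ s → ColumnWalks.col-connected _ (line-interior s)
    ; separated = λ e p q → near-lines (subst₂ (Near 2) p q (proj₂ (edge-near e)))
    }
  ; meet = λ s s′ → cycle-vertex (line-interior s) (line-interior s′) north , refl , refl
  }
  where
    open TGeometry (3 + N * 3)
    open TLines (2 + N * 3) (s≤s (s≤s z≤n))

    line-interior : (s : Fin N) → Interior (line (toℕ s))
    line-interior s = s≤s (s≤s z≤n) , s≤s (s≤s (s≤s (*-monoˡ-≤ 3 (Finₚ.toℕ≤n s))))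

lemma5 : Σ (ℕ → ℕ) λ f → ∀ n → 1 ≤ n →
           3 ≤ f n × (∀ (H : Graph) → Subdivision H (T (f n)) → CWGreaterThan n H)
lemma5 = (λ n → 3 + suc (n + n) * 3) , λ n _ →
  m≤m+n 3 _ , λ H sub k k≤n (e , e≅H) →
    no-gridLike (s≤s (+-mono-≤ k≤n k≤n)) e
      (≅-gridLike⁻ e≅H (subdivision-gridLike sub (T-gridLike (suc (n + n)))))
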